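{- If $T$ is a storage operator, then, for every successor $\underline{S}$, $T$ is an $\underline{S}$-storage operator.
   Context: Notation: $(t)u$ denotes application of $t$ to $u$, and $(t)u_1\dots u_n$ stands for $(\dots((t)u_1)\dots)u_n$; $\overline{c}$ denotes a finite sequence of terms $c_1,\dots,c_k$. $u \succ v$ means $v$ is obtained from $u$ by finitely many head-reduction steps. $(u)^0v=v$, $(u)^{n+1}v=(u)(u)^nv$. For each $n$, the Church integer is $\underline{n}=\lambda f\lambda x (f)^n x$. A closed $\lambda$-term $\underline{S}$ is a successor iff $(\underline{S})\underline{k}\simeq_\beta \underline{k+1}$ for every $k\ge 0$. A closed $\lambda$-term $T$ is a storage operator iff for every $n\ge 0$ there is a closed $\lambda$-term $\tau_n\simeq_\beta \underline{n}$ such that for every $\theta_n\simeq_\beta\underline{n}$, $(T)\theta_n f \succ (f)\tau_n$ (where $f$ is a fresh variable). $\lambda X$-terms: terms built from variables and constants $X_i$ ($i\ge 0$) by abstraction and application, together with constants $X_{n,a,b,\overline{c}}$ for every $n\in\mathbb N$ and $\lambda X$-terms $a,b,\overline{c}$ ($X_{n,a,b,\overline{c}}$ is regarded as a constant not occurring in $a,b,\overline{c}$). Given a successor $\underline{S}$, a closed $\lambda$-term $T$ is an $\underline{S}$-storage operator iff for every $n\ge 0$ there is a finite sequence of head reductions $U_i\succ V_i$ ($1\le i\le r$) such that: (1) all $U_i,V_i$ are $\lambda X$-terms; (2) $U_1=(T)X_n f$ and $V_r=(f)\tau_n$ with $\tau_n$ a closed $\lambda$-term $\beta$-equivalent to $\underline{n}$;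 (3) for $i<r$, $V_i=(X_n)ab\overline{c}$ or $V_i=(X_{l,a,b,\overline{c}})uv\overline{w}$ with $0\le l\le n-1$; (4) if $V_i=(X_n)ab\overline{c}$ then $U_{i+1}=(\underline{0})ab\overline{c}$ if $n=0$ and $U_{i+1}=((\underline{S})X_{n-1,a,b,\overline{c}})ab\overline{c}$ if $n\ne 0$; (5) if $V_i=(X_{l,a,b,\overline{c}})uv\overline{w}$ then $U_{i+1}=(\underline{0})uv\overline{w}$ if $l=0$ and $U_{i+1}=((\underline{S})X_{l-1,u,v,\overline{w}})uv\overline{w}$ if $l\ne 0$. -}

module Defs where

open import Data.Nat using (ℕ; zero; suc; _<_; _<ᵇ_; _≡ᵇ_; pred)
open import Data.Bool using (if_then_else_)
open import Data.List using (List; []; _∷_)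
open import Data.Product using (Σ; _×_; _,_)
open import Relation.Nullary using (¬_)
open import Relation.Binary.Construct.Closure.ReflexiveTransitive using (Star)
open import Relation.Binary.Construct.Closure.Equivalence using (EqClosure)

-- X n          is the constant X_n
--   XX n a b cs  is the constant X_{n,a,b,c̄}  (an atomic constant: substitution
--                does not enter it)
-- Pure λ-terms are the λX-terms containing no constants (predicate Pure).
data ΛX : Set where
  var : ℕ → ΛX
  lam : ΛX → ΛX
  app : ΛX → ΛX → ΛX
  X   : ℕ → ΛX
  XX  : ℕ → ΛX → ΛX → List ΛX → ΛX

data Pure : ΛX → Set where
  var : ∀ i → Pure (var i)
  lam : ∀ {t} → Pure t → Pure (lam t)
  app : ∀ {t u} → Pure t → Pure u → Pure (app t u)

data Free : ℕ → ΛX → Set where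
  var  : ∀ i → Free i (var i)
  lam  : ∀ {i t} → Free (suc i) t → Free i (lam t)
  appl : ∀ {i t u} → Free i t → Free i (app t u)
  appr : ∀ {i t u} → Free i u → Free i (app t u)

Closed : ΛX → Set
Closed t = ∀ i → ¬ Free i t

app* : ΛX → List ΛX → ΛX
app* t []       = t
app* t (u ∷ us) = app* (app t u) us

shift : ℕ → ΛX → ΛX
shift c (var i)       = if i <ᵇ c then var i else var (suc i)
shift c (lam t)       = lam (shift (suc c) t)
shift c (app t u)     = app (shift c t) (shift c u)
shift c (X n)         = X n
shift c (XX n a b cs) = XX n a b cs

sub : ℕ → ΛX → ΛX → ΛX
sub k s (var i)       = if i <ᵇ k then var i else (if i ≡ᵇ k then s else var (pred i))
sub k s (lam t)       = lam (sub (suc k) (shift 0 s) t)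
sub k s (app t u)     = app (sub k s t) (sub k s u)
sub k s (X n)         = X n
sub k s (XX n a b cs) = XX n a b cs

data _→β_ : ΛX → ΛX → Set where
  β    : ∀ {u v} → app (lam u) v →β sub 0 v u
  appl : ∀ {t t' u} → t →β t' → app t u →β app t' u
  appr : ∀ {t u u'} → u →β u' → app t u →β app t u'
  lam  : ∀ {t t'} → t →β t' → lam t →β lam t'

_≃β_ : ΛX → ΛX → Set
_≃β_ = EqClosure _→β_

data _→h_ : ΛX → ΛX → Set where
  β    : ∀ {u v} → app (lam u) v →h sub 0 v u
  appl : ∀ {t u v w} → app t u →h w → app (app t u) v →h app w v
  lam  : ∀ {t t'} → t →h t' → lam t →h lam t'

_≻_ : ΛX → ΛX → Set
_≻_ = Star _→h_

iter : ℕ → ΛX → ΛX → ΛX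
iter zero    u v = v
iter (suc n) u v = app u (iter n u v)

church : ℕ → ΛX
church n = lam (lam (iter n (var 1) (var 0)))

IsSuccessor : ΛX → Set
IsSuccessor S = Closed S × Pure S × (∀ k → app S (church k) ≃β church (suc k))

IsStorageOperator : ΛX → Set
IsStorageOperator T =
  Closed T × Pure T ×
  (∀ n → Σ ΛX λ τ → Closed τ × Pure τ × (τ ≃β church n) ×
     (∀ θ → Pure θ → θ ≃β church n → ∀ f → ¬ Free f θ →
        app (app T θ) (var f) ≻ app (var f) τ))

-- the term U_{i+1} following V_i = (X_l) a b c̄  (resp. (X_{l,…}) a b c̄)
next : ΛX → ℕ → ΛX → ΛX → List ΛX → ΛX
next S zero    a b cs = app* (church 0) (a ∷ b ∷ cs)
next S (suc l) a b cs = app* (app S (XX l a b cs)) (a ∷ b ∷ cs)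

-- Run S n U : there is a finite sequence of head reductions U_i ≻ V_i (1 ≤ i ≤ r)
-- with U_1 = U satisfying conditions (2)–(5); f is the variable var 0.
data Run (S : ΛX) (n : ℕ) : ΛX → Set where
  finish : ∀ {U} (τ : ΛX) → Closed τ → Pure τ → τ ≃β church n →
           U ≻ app (var 0) τ → Run S n U
  viaX   : ∀ {U} (a b : ΛX) (cs : List ΛX) →
           U ≻ app* (X n) (a ∷ b ∷ cs) →
           Run S n (next S n a b cs) → Run S n U
  viaXX  : ∀ {U} (l : ℕ) (a b : ΛX) (cs : List ΛX) (u v : ΛX) (ws : List ΛX) →
           l < n →
           U ≻ app* (XX l a b cs) (u ∷ v ∷ ws) →
           Run S n (next S l u v ws) → Run S n U

IsSStorageOperator : ΛX → ΛX → Set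
IsSStorageOperator S T =
  Closed T × Pure T × (∀ n → Run S n (app (app T (X n)) (var 0)))

-- Run the head reduction of (T) X_n f symbolically.  Replacing every constant X_l and
-- X_{l,a,b,c̄} by a realisation θ_l of the Church integer l, with θ_{l+1} = λfλx ((S) θ_l) f x,
-- turns each term U of the run into a closed term σ U; for the first term σ U = (T) θ_n f,
-- which head-reduces to (f) τ because T is a storage operator.  Head reduction is
-- deterministic and commutes with σ, so every head step of U is a step of σ U; and when U is
-- a constant applied to a, b, c̄, two steps of σ U turn θ_{l+1} a b c̄ into (S) θ_l a b c̄, the
-- image of the term prescribed by (5), while θ_0 a b c̄ reduces to b c̄ just as (0) a b c̄ does.
-- Finally U = (f) τ'.  Running this for two realisations that differ only at θ_0 (λλ0 and
-- λλ(λ0)0) gives σ₁ τ' = τ = σ₂ τ', so τ' contains no constant and is τ itself.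
module Submission where

open import Defs
open import Data.Nat using (ℕ; zero; suc; _+_; _<_; _≤_; _<ᵇ_; _≡ᵇ_; _<?_; s≤s)
open import Data.Nat.Properties using (≮⇒≥; <⇒<ᵇ; <⇒≤; ≤-refl)
open import Data.Bool using (true; false)
open import Data.List using ([]; _∷_; _++_; map)
open import Data.List.Relation.Unary.All using (All; []; _∷_)
open import Data.Product using (∃; _×_; _,_)
open import Data.Empty using (⊥-elim)
open import Function using (_∘_)
open import Relation.Nullary using (¬_; yes; no)
open import Relation.Binary.PropositionalEquality
open import Relation.Binary.Construct.Closure.ReflexiveTransitive using (ε; _◅_; _◅◅_; return)
open import Relation.Binary.Construct.Closure.Symmetric using (fwd)
import Relation.Binary.Construct.Closure.Equivalence as EqClosure

lam-injective : ∀ {t u : ΛX} → lam t ≡ lam u → t ≡ u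
lam-injective refl = refl

app-injective : ∀ {t t′ u u′ : ΛX} → app t u ≡ app t′ u′ → t ≡ t′ × u ≡ u′
app-injective refl = refl , refl

app*-snoc : ∀ h args u → app* h (args ++ u ∷ []) ≡ app (app* h args) u
app*-snoc h []         u = refl
app*-snoc h (a ∷ args) u = app*-snoc (app h a) args u

app-closed : ∀ {t u} → Closed t → Closed u → Closed (app t u)
app-closed t-closed u-closed i (appl fr) = t-closed i fr
app-closed t-closed u-closed i (appr fr) = u-closed i fr

FreeBelow : ℕ → ΛX → Set
FreeBelow k t = ∀ i → k ≤ i → ¬ Free i t

free-below-var : ∀ {k i} → FreeBelow k (var i) → i < k
free-below-var {k} {i} h with i <? k
... | yes i<k = i<k
... | no  i≮k = ⊥-elim (h i (≮⇒≥ i≮k) (var i))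

free-below-lam : ∀ {k t} → FreeBelow k (lam t) → FreeBelow (suc k) t
free-below-lam h (suc i) (s≤s k≤i) fr = h i k≤i (lam fr)

free-below-appˡ : ∀ {k t u} → FreeBelow k (app t u) → FreeBelow k t
free-below-appˡ h i k≤i = h i k≤i ∘ appl

free-below-appʳ : ∀ {k t u} → FreeBelow k (app t u) → FreeBelow k u
free-below-appʳ h i k≤i = h i k≤i ∘ appr

shift-free-below : ∀ c t → FreeBelow c t → shift c t ≡ t
shift-free-below c (var i) h with i <ᵇ c | <⇒<ᵇ (free-below-var h)
... | true | _ = refl
shift-free-below c (lam t)      h = cong lam (shift-free-below (suc c) t (free-below-lam h))
shift-free-below c (app t u)    h =
  cong₂ app (shift-free-below c t (free-below-appˡ h)) (shift-free-below c u (free-below-appʳ h))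
shift-free-below c (X _)        h = refl
shift-free-below c (XX _ _ _ _) h = refl

sub-free-below : ∀ k s t → FreeBelow k t → sub k s t ≡ t
sub-free-below k s (var i) h with i <ᵇ k | <⇒<ᵇ (free-below-var h)
... | true | _ = refl
sub-free-below k s (lam t)      h = cong lam (sub-free-below (suc k) (shift 0 s) t (free-below-lam h))
sub-free-below k s (app t u)    h =
  cong₂ app (sub-free-below k s t (free-below-appˡ h)) (sub-free-below k s u (free-below-appʳ h))
sub-free-below k s (X _)        h = refl
sub-free-below k s (XX _ _ _ _) h = refl

shift-closed : ∀ c {t} → Closed t → shift c t ≡ t
shift-closed c {t} t-closed = shift-free-below c t (λ i _ → t-closed i)

sub-closed : ∀ k s {t} → Closed t → sub k s t ≡ t
sub-closed k s {t} t-closed = sub-free-below k s t (λ i _ → t-closed i)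

<ᵇ-false⇒suc-<ᵇ-false : ∀ i c → (i <ᵇ c) ≡ false → (suc i <ᵇ c) ≡ false
<ᵇ-false⇒suc-<ᵇ-false i       zero    _ = refl
<ᵇ-false⇒suc-<ᵇ-false (suc i) (suc c) e = <ᵇ-false⇒suc-<ᵇ-false i c e

<ᵇ-false⇒suc-≡ᵇ-false : ∀ i c → (i <ᵇ c) ≡ false → (suc i ≡ᵇ c) ≡ false
<ᵇ-false⇒suc-≡ᵇ-false i       zero    _ = refl
<ᵇ-false⇒suc-≡ᵇ-false (suc i) (suc c) e = <ᵇ-false⇒suc-≡ᵇ-false i c e

sub-shift : ∀ c s t → sub c s (shift c t) ≡ t
sub-shift c s (var i) with i <ᵇ c in e
... | true  rewrite e = refl
... | false rewrite <ᵇ-false⇒suc-<ᵇ-false i c e | <ᵇ-false⇒suc-≡ᵇ-false i c e = refl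
sub-shift c s (lam t)      = cong lam (sub-shift (suc c) (shift 0 s) t)
sub-shift c s (app t u)    = cong₂ app (sub-shift c s t) (sub-shift c s u)
sub-shift c s (X _)        = refl
sub-shift c s (XX _ _ _ _) = refl

sub-iter : ∀ k s m u v → sub k s (iter m u v) ≡ iter m (sub k s u) (sub k s v)
sub-iter k s zero    u v = refl
sub-iter k s (suc m) u v = cong (app (sub k s u)) (sub-iter k s m u v)

instantiate : (ℕ → ΛX) → ΛX → ΛX
instantiate g (var i)      = var i
instantiate g (lam t)      = lam (instantiate g t)
instantiate g (app t u)    = app (instantiate g t) (instantiate g u)
instantiate g (X m)        = g m
instantiate g (XX l _ _ _) = g l

instantiate-pure : ∀ g {t} → Pure t → instantiate g t ≡ t
instantiate-pure g (var i)   = refl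
instantiate-pure g (lam p)   = cong lam (instantiate-pure g p)
instantiate-pure g (app p q) = cong₂ app (instantiate-pure g p) (instantiate-pure g q)

instantiate-app* : ∀ g h args → instantiate g (app* h args) ≡ app* (instantiate g h) (map (instantiate g) args)
instantiate-app* g h []         = refl
instantiate-app* g h (a ∷ args) = instantiate-app* g (app h a) args

instantiations-agree⇒pure : ∀ {g₁ g₂} → (∀ l → g₁ l ≢ g₂ l) →
                             ∀ t → instantiate g₁ t ≡ instantiate g₂ t → Pure t
instantiations-agree⇒pure g₁≢g₂ (var i)      e = var i
instantiations-agree⇒pure g₁≢g₂ (lam t)      e = lam (instantiations-agree⇒pure g₁≢g₂ t (lam-injective e))
instantiations-agree⇒pure g₁≢g₂ (app t u)    e with app-injective e
... | eₜ , eᵤ = app (instantiations-agree⇒pure g₁≢g₂ t eₜ) (instantiations-agree⇒pure g₁≢g₂ u eᵤ)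
instantiations-agree⇒pure g₁≢g₂ (X m)        e = ⊥-elim (g₁≢g₂ m e)
instantiations-agree⇒pure g₁≢g₂ (XX l _ _ _) e = ⊥-elim (g₁≢g₂ l e)

module _ (g : ℕ → ΛX) (g-closed : ∀ l → Closed (g l)) where

  instantiate-shift : ∀ c t → instantiate g (shift c t) ≡ shift c (instantiate g t)
  instantiate-shift c (var i) with i <ᵇ c
  ... | true  = refl
  ... | false = refl
  instantiate-shift c (lam t)      = cong lam (instantiate-shift (suc c) t)
  instantiate-shift c (app t u)    = cong₂ app (instantiate-shift c t) (instantiate-shift c u)
  instantiate-shift c (X m)        = sym (shift-closed c (g-closed m))
  instantiate-shift c (XX l _ _ _) = sym (shift-closed c (g-closed l))

  instantiate-sub : ∀ k s t → instantiate g (sub k s t) ≡ sub k (instantiate g s) (instantiate g t)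
  instantiate-sub k s (var i) with i <ᵇ k
  ... | true = refl
  ... | false with i ≡ᵇ k
  ... | true  = refl
  ... | false = refl
  instantiate-sub k s (lam t) =
    cong lam (trans (instantiate-sub (suc k) (shift 0 s) t)
                    (cong (λ s′ → sub (suc k) s′ (instantiate g t)) (instantiate-shift 0 s)))
  instantiate-sub k s (app t u)    = cong₂ app (instantiate-sub k s t) (instantiate-sub k s u)
  instantiate-sub k s (X m)        = sym (sub-closed k (instantiate g s) (g-closed m))
  instantiate-sub k s (XX l _ _ _) = sym (sub-closed k (instantiate g s) (g-closed l))

  instantiate-→h : ∀ {U V} → U →h V → instantiate g U →h instantiate g V
  instantiate-→h (β {u} {v}) = subst (app (lam (instantiate g u)) (instantiate g v) →h_) (sym (instantiate-sub 0 v u)) β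
  instantiate-→h (appl s)    = appl (instantiate-→h s)
  instantiate-→h (lam s)     = lam (instantiate-→h s)

-- The terms occurring in an S-run for n: their constants are X_n and X_{l,a,b,c̄} with l < n.
data Admissible (n : ℕ) : ΛX → Set where
  var : ∀ i → Admissible n (var i)
  lam : ∀ {t} → Admissible n t → Admissible n (lam t)
  app : ∀ {t u} → Admissible n t → Admissible n u → Admissible n (app t u)
  X   : Admissible n (X n)
  XX  : ∀ {l a b cs} → l < n → Admissible n (XX l a b cs)

module _ {n : ℕ} where

  admissible-pure : ∀ {t} → Pure t → Admissible n t
  admissible-pure (var i)   = var i
  admissible-pure (lam p)   = lam (admissible-pure p)
  admissible-pure (app p q) = app (admissible-pure p) (admissible-pure q)

  admissible-shift : ∀ c {t} → Admissible n t → Admissible n (shift c t)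
  admissible-shift c (var i) with i <ᵇ c
  ... | true  = var i
  ... | false = var (suc i)
  admissible-shift c (lam w)   = lam (admissible-shift (suc c) w)
  admissible-shift c (app w v) = app (admissible-shift c w) (admissible-shift c v)
  admissible-shift c X         = X
  admissible-shift c (XX l<n)  = XX l<n

  admissible-sub : ∀ k {s t} → Admissible n s → Admissible n t → Admissible n (sub k s t)
  admissible-sub k ws (var i) with i <ᵇ k
  ... | true = var i
  ... | false with i ≡ᵇ k
  ... | true  = ws
  ... | false = var _
  admissible-sub k ws (lam w)   = lam (admissible-sub (suc k) (admissible-shift 0 ws) w)
  admissible-sub k ws (app w v) = app (admissible-sub k ws w) (admissible-sub k ws v)
  admissible-sub k ws X         = X
  admissible-sub k ws (XX l<n)  = XX l<n

  admissible-→h : ∀ {U V} → Admissible n U → U →h V → Admissible n V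
  admissible-→h (app (lam w) v) β        = admissible-sub 0 v w
  admissible-→h (app w v)       (appl s) = app (admissible-→h w s) v
  admissible-→h (lam w)         (lam s)  = lam (admissible-→h w s)

  admissible-app*⁻ : ∀ h args → Admissible n (app* h args) → Admissible n h × All (Admissible n) args
  admissible-app*⁻ h []         w = w , []
  admissible-app*⁻ h (a ∷ args) w with admissible-app*⁻ (app h a) args w
  ... | app wh wa , wargs = wh , wa ∷ wargs

  admissible-app*⁺ : ∀ {h args} → Admissible n h → All (Admissible n) args → Admissible n (app* h args)
  admissible-app*⁺ wh []             = wh
  admissible-app*⁺ wh (wa ∷ wargs)   = admissible-app*⁺ (app wh wa) wargs

→h-deterministic : ∀ {A B C} → A →h B → A →h C → B ≡ C
→h-deterministic β        β         = refl
→h-deterministic (appl s) (appl s′) = cong (λ t → app t _) (→h-deterministic s s′)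
→h-deterministic (lam s)  (lam s′)  = cong lam (→h-deterministic s s′)

app*-→h : ∀ {t u w} zs → app t u →h w → app* (app t u) zs →h app* w zs
app*-→h []       s = s
app*-→h (z ∷ zs) s = app*-→h zs (appl s)

data VarHeaded : ΛX → Set where
  var : ∀ i → VarHeaded (var i)
  app : ∀ {t u} → VarHeaded t → VarHeaded (app t u)

lam-not-varHeaded : ∀ {t} → ¬ VarHeaded (lam t)
lam-not-varHeaded ()

varHeaded-app* : ∀ {t} zs → VarHeaded t → VarHeaded (app* t zs)
varHeaded-app* []       h = h
varHeaded-app* (z ∷ zs) h = varHeaded-app* zs (app h)

varHeaded-irreducible : ∀ {t u} → VarHeaded t → ¬ (t →h u)
varHeaded-irreducible (app ())  β
varHeaded-irreducible (app h)   (appl s) = varHeaded-irreducible h s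

varHeaded-normal : ∀ {t u} → VarHeaded t → t ≻ u → t ≡ u
varHeaded-normal h ε       = refl
varHeaded-normal h (s ◅ _) = ⊥-elim (varHeaded-irreducible h s)

data Atom : ΛX → Set where
  var : ∀ i → Atom (var i)
  X   : ∀ m → Atom (X m)
  XX  : ∀ l a b cs → Atom (XX l a b cs)

data HeadView : ΛX → Set where
  redex       : ∀ {U U′} → U →h U′ → HeadView U
  abstraction : ∀ t → HeadView (lam t)
  spine       : ∀ {h} → Atom h → ∀ args → HeadView (app* h args)

headView-app : ∀ {t} → HeadView t → ∀ u → HeadView (app t u)
headView-app (redex β)           u = redex (appl β)
headView-app (redex (appl s))    u = redex (appl (appl s))
headView-app (redex (lam s))     u = redex β
headView-app (abstraction t)     u = redex β
headView-app (spine {h} a args)  u = subst HeadView (app*-snoc h args u) (spine a (args ++ u ∷ []))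

headView : ∀ U → HeadView U
headView (var i)         = spine (var i) []
headView (lam t)         = abstraction t
headView (app t u)       = headView-app (headView t) u
headView (X m)           = spine (X m) []
headView (XX l a b cs)   = spine (XX l a b cs) []

infix  4 _≻⟨_⟩_
infixr 5 _◅_

data _≻⟨_⟩_ : ΛX → ℕ → ΛX → Set where
  ε   : ∀ {A} → A ≻⟨ 0 ⟩ A
  _◅_ : ∀ {A B C k} → A →h B → B ≻⟨ k ⟩ C → A ≻⟨ suc k ⟩ C

count : ∀ {A B} → A ≻ B → ∃ λ k → A ≻⟨ k ⟩ B
count ε       = 0 , ε
count (s ◅ r) with count r
... | k , r′ = suc k , s ◅ r′

forget : ∀ {A B k} → A ≻⟨ k ⟩ B → A ≻ B
forget ε       = ε
forget (s ◅ r) = s ◅ forget r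

module _ {G : ΛX} (G-varHeaded : VarHeaded G) where

  peel : ∀ {A B j k} → A ≻⟨ j ⟩ B → A ≻⟨ k ⟩ G → ∃ λ k′ → k ≡ j + k′ × B ≻⟨ k′ ⟩ G
  peel ε       r       = _ , refl , r
  peel (s ◅ p) ε       = ⊥-elim (varHeaded-irreducible G-varHeaded s)
  peel (s ◅ p) (s′ ◅ r) with →h-deterministic s s′
  ... | refl with peel p r
  ...   | k′ , refl , r′ = k′ , refl , r′

  peel* : ∀ {A B j} → A ≻⟨ j ⟩ B → A ≻ G → B ≻ G
  peel* ε       r        = r
  peel* (s ◅ p) ε        = ⊥-elim (varHeaded-irreducible G-varHeaded s)
  peel* (s ◅ p) (s′ ◅ r) with →h-deterministic s s′
  ... | refl = peel* p r

  abstraction-stuck : ∀ {t k} → ¬ (lam t ≻⟨ k ⟩ G)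
  abstraction-stuck ε           = lam-not-varHeaded G-varHeaded
  abstraction-stuck (lam _ ◅ r) = abstraction-stuck r

  λλ-needs-two-arguments : ∀ {t k} (f : ΛX → ΛX) args → app* (lam (lam t)) (map f args) ≻⟨ k ⟩ G →
                           ∃ λ a → ∃ λ b → ∃ λ cs → args ≡ a ∷ b ∷ cs
  λλ-needs-two-arguments f []           r = ⊥-elim (abstraction-stuck r)
  λλ-needs-two-arguments f (a ∷ [])     r with peel (β ◅ ε) r
  ... | _ , _ , r′ = ⊥-elim (abstraction-stuck r′)
  λλ-needs-two-arguments f (a ∷ b ∷ cs) r = a , b , cs , refl

app*-over-two-not-app-var : ∀ t u v zs {j w} → app* (app (app t u) v) zs ≢ app (var j) w
app*-over-two-not-app-var t u v []       ()
app*-over-two-not-app-var t u v (z ∷ zs) e = app*-over-two-not-app-var (app t u) v z zs e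

var-spine-normal : ∀ (f : ΛX → ΛX) i args {τ} → app* (var i) (map f args) ≻ app (var 0) τ →
                   ∃ λ a → args ≡ a ∷ [] × i ≡ 0 × f a ≡ τ
var-spine-normal f i args r = shape args (varHeaded-normal (varHeaded-app* (map f args) (var i)) r)
  where
  shape : ∀ args {τ} → app* (var i) (map f args) ≡ app (var 0) τ → ∃ λ a → args ≡ a ∷ [] × i ≡ 0 × f a ≡ τ
  shape []           ()
  shape (a ∷ [])     refl = a , refl , refl , refl
  shape (a ∷ b ∷ cs) e    = ⊥-elim (app*-over-two-not-app-var (var i) (f a) (f b) (map f cs) e)

-- λfλx (M) f x, the η-expansion of M when M is closed (M is not shifted under the binders).
η-expand : ΛX → ΛX
η-expand M = lam (lam (app (app M (var 1)) (var 0)))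

η-expand-closed : ∀ {M} → Closed M → Closed (η-expand M)
η-expand-closed M-closed i (lam (lam (appl (appl fr)))) = M-closed _ fr
η-expand-closed M-closed i (lam (lam (appl (appr ()))))
η-expand-closed M-closed i (lam (lam (appr ())))

η-expand-unfolds : ∀ {M} → Closed M → ∀ a b cs →
                   app* (η-expand M) (a ∷ b ∷ cs) ≻⟨ 2 ⟩ app* M (a ∷ b ∷ cs)
η-expand-unfolds {M} M-closed a b cs = app*-→h (b ∷ cs) first ◅ app*-→h cs second ◅ ε
  where
  first : app (η-expand M) a →h lam (app (app M (shift 0 a)) (var 0))
  first = subst (λ M′ → app (η-expand M) a →h lam (app (app M′ (shift 0 a)) (var 0)))
                (sub-closed 1 (shift 0 a) M-closed) β
  second : app (lam (app (app M (shift 0 a)) (var 0))) b →h app (app M a) b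
  second = subst (λ t → app (lam (app (app M (shift 0 a)) (var 0))) b →h app t b)
                 (cong₂ app (sub-closed 0 b M-closed) (sub-shift 0 b a)) β

η-expand-cong : ∀ {M M′} → M ≃β M′ → η-expand M ≃β η-expand M′
η-expand-cong = EqClosure.gmap η-expand (λ r → lam (lam (appl (appl r))))

η-expand-church : ∀ m → η-expand (church m) ≃β church m
η-expand-church m = return (fwd (lam (lam (appl substitute-f)))) ◅◅ return (fwd (lam (lam substitute-x)))
  where
  substitute-f : app (church m) (var 1) →β lam (iter m (var 2) (var 0))
  substitute-f = subst (λ t → app (church m) (var 1) →β lam t) (sub-iter 1 (var 2) m (var 1) (var 0)) β
  substitute-x : app (lam (iter m (var 2) (var 0))) (var 0) →β iter m (var 1) (var 0)
  substitute-x = subst (app (lam (iter m (var 2) (var 0))) (var 0) →β_) (sub-iter 0 (var 0) m (var 2) (var 0)) β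

church-0-selects : ∀ a b cs → app* (church 0) (a ∷ b ∷ cs) ≻⟨ 2 ⟩ app* b cs
church-0-selects a b cs = app*-→h (b ∷ cs) β ◅ app*-→h cs β ◅ ε

church-0′ : ΛX
church-0′ = lam (lam (app (lam (var 0)) (var 0)))

church-0′≃β0 : church-0′ ≃β church 0
church-0′≃β0 = return (fwd (lam (lam β)))

church-0′-selects : ∀ a b cs → app* church-0′ (a ∷ b ∷ cs) ≻⟨ 3 ⟩ app* b cs
church-0′-selects a b cs = app*-→h (b ∷ cs) β ◅ app*-→h cs β ◅ app*-→h cs β ◅ ε

η-numeral : ΛX → ΛX → ℕ → ΛX
η-numeral S b zero    = b
η-numeral S b (suc l) = η-expand (app S (η-numeral S b l))

module _ {S : ΛX} where

  η-numeral-closed : ∀ {b} → Closed S → Closed b → ∀ l → Closed (η-numeral S b l)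
  η-numeral-closed S-closed b-closed zero    = b-closed
  η-numeral-closed S-closed b-closed (suc l) =
    η-expand-closed (app-closed S-closed (η-numeral-closed S-closed b-closed l))

  η-numeral-pure : ∀ {b} → Pure S → Pure b → ∀ l → Pure (η-numeral S b l)
  η-numeral-pure S-pure b-pure zero    = b-pure
  η-numeral-pure S-pure b-pure (suc l) =
    lam (lam (app (app (app S-pure (η-numeral-pure S-pure b-pure l)) (var 1)) (var 0)))

  η-numeral-≃β : ∀ {b} → (∀ k → app S (church k) ≃β church (suc k)) → b ≃β church 0 →
                 ∀ l → η-numeral S b l ≃β church l
  η-numeral-≃β S-succ b≃0 zero    = b≃0
  η-numeral-≃β S-succ b≃0 (suc l) =
    η-expand-cong (EqClosure.gmap (app S) appr (η-numeral-≃β S-succ b≃0 l)) ◅◅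
    η-expand-cong (S-succ l) ◅◅ η-expand-church (suc l)

  η-numeral-injective : ∀ {b b′} l → η-numeral S b l ≡ η-numeral S b′ l → b ≡ b′
  η-numeral-injective zero    e = e
  η-numeral-injective (suc l) e = η-numeral-injective l (cong predecessor e)
    where
    predecessor : ΛX → ΛX
    predecessor (lam (lam (app (app (app _ θ) _) _))) = θ
    predecessor t                                     = t

  η-numeral-λλ : ∀ t l → ∃ λ t′ → η-numeral S (lam (lam t)) l ≡ lam (lam t′)
  η-numeral-λλ t zero    = t , refl
  η-numeral-λλ t (suc l) = _ , refl

prepend : ∀ {S n U U′} → U ≻ U′ → Run S n U′ → Run S n U
prepend r (finish τ τ-closed τ-pure τ≃n r′)    = finish τ τ-closed τ-pure τ≃n (r ◅◅ r′)
prepend r (viaX a b cs r′ run)                 = viaX a b cs (r ◅◅ r′) run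
prepend r (viaXX l a b cs u v ws l<n r′ run)   = viaXX l a b cs u v ws l<n (r ◅◅ r′) run

church-0-closed : Closed (church 0)
church-0-closed i (lam (lam ()))

church-0′-closed : Closed church-0′
church-0′-closed i (lam (lam (appl (lam ()))))
church-0′-closed i (lam (lam (appr ())))

module Simulation (S : ΛX) (S-closed : Closed S) (S-pure : Pure S) (n : ℕ)
                  (τ : ΛX) (τ-closed : Closed τ) (τ-pure : Pure τ) (τ≃n : τ ≃β church n) where

  θ₁ θ₂ : ℕ → ΛX
  θ₁ = η-numeral S (church 0)
  θ₂ = η-numeral S church-0′

  θ₁-closed : ∀ l → Closed (θ₁ l)
  θ₁-closed = η-numeral-closed S-closed church-0-closed

  θ₂-closed : ∀ l → Closed (θ₂ l)
  θ₂-closed = η-numeral-closed S-closed church-0′-closed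

  θ₁≢θ₂ : ∀ l → θ₁ l ≢ θ₂ l
  θ₁≢θ₂ l e with η-numeral-injective l e
  ... | ()

  σ₁ σ₂ : ΛX → ΛX
  σ₁ = instantiate θ₁
  σ₂ = instantiate θ₂

  G : ΛX
  G = app (var 0) τ

  G-varHeaded : VarHeaded G
  G-varHeaded = app (var 0)

  instantiate-next-suc : ∀ θ l a b cs →
    instantiate θ (next S (suc l) a b cs) ≡ app* (app S (θ l)) (map (instantiate θ) (a ∷ b ∷ cs))
  instantiate-next-suc θ l a b cs =
    trans (instantiate-app* θ (app S (XX l a b cs)) (a ∷ b ∷ cs))
          (cong (λ S′ → app* (app S′ (θ l)) (map (instantiate θ) (a ∷ b ∷ cs))) (instantiate-pure θ S-pure))

  θ₁-needs-two-arguments : ∀ {k} l args → app* (θ₁ l) (map σ₁ args) ≻⟨ k ⟩ G →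
                           ∃ λ a → ∃ λ b → ∃ λ cs → args ≡ a ∷ b ∷ cs
  θ₁-needs-two-arguments l args r with η-numeral-λλ (var 0) l
  ... | _ , e = λλ-needs-two-arguments G-varHeaded σ₁ args (subst (λ h → app* h (map σ₁ args) ≻⟨ _ ⟩ G) e r)

  argument≡τ : ∀ a → σ₁ a ≡ τ → σ₂ a ≡ τ → a ≡ τ
  argument≡τ a σ₁a≡τ σ₂a≡τ = trans (sym (instantiate-pure θ₁ a-pure)) σ₁a≡τ
    where
    a-pure : Pure a
    a-pure = instantiations-agree⇒pure θ₁≢θ₂ a (trans σ₁a≡τ (sym σ₂a≡τ))

  -- Recursion on the length k of the reduction of σ₁ U: every round consumes part of it.
  mutual
    simulate : ∀ k U → Admissible n U → σ₁ U ≻⟨ k ⟩ G → σ₂ U ≻ G → Run S n U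
    simulate k U w r₁ r₂ with headView U
    ... | redex s with peel G-varHeaded (instantiate-→h θ₁ θ₁-closed s ◅ ε) r₁
    ...   | k′ , refl , r₁′ =
      prepend (return s)
        (simulate k′ _ (admissible-→h w s) r₁′ (peel* G-varHeaded (instantiate-→h θ₂ θ₂-closed s ◅ ε) r₂))
    simulate k _ w r₁ r₂ | abstraction t = ⊥-elim (abstraction-stuck G-varHeaded r₁)
    simulate k _ w r₁ r₂ | spine (var i) args
      with var-spine-normal σ₁ i args (subst (_≻ G) (instantiate-app* θ₁ (var i) args) (forget r₁))
         | var-spine-normal σ₂ i args (subst (_≻ G) (instantiate-app* θ₂ (var i) args) r₂)
    ... | a , refl , refl , σ₁a≡τ | _ , refl , _ , σ₂a≡τ with argument≡τ a σ₁a≡τ σ₂a≡τ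
    ...   | refl = finish τ τ-closed τ-pure τ≃n ε
    simulate k _ w r₁ r₂ | spine (X m) args
      with θ₁-needs-two-arguments m args (subst (_≻⟨ k ⟩ G) (instantiate-app* θ₁ (X m) args) r₁)
    ... | a , b , cs , refl with admissible-app*⁻ (X m) (a ∷ b ∷ cs) w
    ...   | X , wa ∷ wb ∷ wcs =
      viaX a b cs ε
        (unfold k n a b cs ≤-refl wa wb wcs
          (subst (_≻⟨ k ⟩ G) (instantiate-app* θ₁ (X n) (a ∷ b ∷ cs)) r₁)
          (subst (_≻ G) (instantiate-app* θ₂ (X n) (a ∷ b ∷ cs)) r₂))
    simulate k _ w r₁ r₂ | spine (XX l a₀ b₀ cs₀) args
      with θ₁-needs-two-arguments l args (subst (_≻⟨ k ⟩ G) (instantiate-app* θ₁ (XX l a₀ b₀ cs₀) args) r₁)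
    ... | a , b , cs , refl with admissible-app*⁻ (XX l a₀ b₀ cs₀) (a ∷ b ∷ cs) w
    ...   | XX l<n , wa ∷ wb ∷ wcs =
      viaXX l a₀ b₀ cs₀ a b cs l<n ε
        (unfold k l a b cs (<⇒≤ l<n) wa wb wcs
          (subst (_≻⟨ k ⟩ G) (instantiate-app* θ₁ (XX l a₀ b₀ cs₀) (a ∷ b ∷ cs)) r₁)
          (subst (_≻ G) (instantiate-app* θ₂ (XX l a₀ b₀ cs₀) (a ∷ b ∷ cs)) r₂))

    unfold : ∀ k l a b cs → l ≤ n → Admissible n a → Admissible n b → All (Admissible n) cs →
             app* (θ₁ l) (map σ₁ (a ∷ b ∷ cs)) ≻⟨ k ⟩ G → app* (θ₂ l) (map σ₂ (a ∷ b ∷ cs)) ≻ G →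
             Run S n (next S l a b cs)
    unfold k zero a b cs _ wa wb wcs r₁ r₂
      with peel G-varHeaded (church-0-selects (σ₁ a) (σ₁ b) (map σ₁ cs)) r₁
    ... | k′ , refl , r₁′ =
      prepend (forget (church-0-selects a b cs))
        (simulate k′ (app* b cs) (admissible-app*⁺ wb wcs)
          (subst (_≻⟨ k′ ⟩ G) (sym (instantiate-app* θ₁ b cs)) r₁′)
          (subst (_≻ G) (sym (instantiate-app* θ₂ b cs))
            (peel* G-varHeaded (church-0′-selects (σ₂ a) (σ₂ b) (map σ₂ cs)) r₂)))
    unfold k (suc l) a b cs l<n wa wb wcs r₁ r₂
      with peel G-varHeaded (η-expand-unfolds (app-closed S-closed (θ₁-closed l)) (σ₁ a) (σ₁ b) (map σ₁ cs)) r₁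
    ... | k′ , refl , r₁′ =
      simulate k′ (next S (suc l) a b cs)
        (admissible-app*⁺ (app (admissible-pure S-pure) (XX l<n)) (wa ∷ wb ∷ wcs))
        (subst (_≻⟨ k′ ⟩ G) (sym (instantiate-next-suc θ₁ l a b cs)) r₁′)
        (subst (_≻ G) (sym (instantiate-next-suc θ₂ l a b cs))
          (peel* G-varHeaded (η-expand-unfolds (app-closed S-closed (θ₂-closed l)) (σ₂ a) (σ₂ b) (map σ₂ cs)) r₂))

  run-of-storage : ∀ {T} → Pure T → (∀ k → app S (church k) ≃β church (suc k)) →
                   (∀ θ → Pure θ → θ ≃β church n → ∀ f → ¬ Free f θ → app (app T θ) (var f) ≻ app (var f) τ) →
                   Run S n (app (app T (X n)) (var 0))
  run-of-storage {T} T-pure S-succ stores =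
    let k , r₁ = count (stored church-0-closed (lam (lam (var 0))) ε)
    in simulate k _ (app (app (admissible-pure T-pure) X) (var 0)) r₁
                (stored church-0′-closed (lam (lam (app (lam (var 0)) (var 0)))) church-0′≃β0)
    where
    stored : ∀ {b} → Closed b → Pure b → b ≃β church 0 → instantiate (η-numeral S b) (app (app T (X n)) (var 0)) ≻ G
    stored {b} b-closed b-pure b≃0 =
      subst (λ T′ → app (app T′ (η-numeral S b n)) (var 0) ≻ G) (sym (instantiate-pure (η-numeral S b) T-pure))
        (stores (η-numeral S b n) (η-numeral-pure S-pure b-pure n) (η-numeral-≃β S-succ b≃0 n)
                0 (η-numeral-closed S-closed b-closed n 0))

theorem1 : (T : ΛX) → IsStorageOperator T →
    (S : ΛX) → IsSuccessor S → IsSStorageOperator S T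
theorem1 T (T-closed , T-pure , storage) S (S-closed , S-pure , S-succ) = T-closed , T-pure , run
  where
  run : ∀ n → Run S n (app (app T (X n)) (var 0))
  run n =
    let τ , τ-closed , τ-pure , τ≃n , stores = storage n
    in Simulation.run-of-storage S S-closed S-pure n τ τ-closed τ-pure τ≃n T-pure S-succ stores
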